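{- Existential second-order universal Horn logic does not capture the complexity class $\mathbf{P}$ of problems decidable in polynomial time, even when input structures are assumed to come with a successor relation. That is, there is a decision problem in $\mathbf{P}$, given as a class of finite structures over a vocabulary containing a successor relation, that is not the class of finite models of any ESO universal Horn sentence.
   Context: An ESO universal Horn sentence over an input (first-order) vocabulary $\sigma$ is a sentence of the form $\exists R_1 \cdots \exists R_k\, \forall \bar{x}\, \psi$, where $R_1,\dots,R_k$ are second-order (quantified) relation variables not in $\sigma$, and $\psi$ is a quantifier-free formula that is a conjunction of clauses (disjunctions of literals) in which each clause contains at most one positive (unnegated) occurrence of an atom built from $R_1,\dots,R_k$; atoms over the input vocabulary $\sigma$ may occur positively or negatively without restriction. A decision problem (a class of finite $\sigma$-structures) is expressed by such a sentence if exactly the structures in the class satisfy it. A successor relation on a finite universe $\{0,1,\dots,m\}$ is the relation $\{(i,i+1) : 0 \le i < m\}$, included in the input vocabulary. -}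

module Defs where

open import Data.Nat using (ℕ; zero; suc; _+_; _*_; _^_; _≤_)
open import Data.Fin using (Fin; toℕ)
open import Data.Bool using (Bool; true; false; _∧_; _∨_; not; if_then_else_)
open import Data.List using (List; []; _∷_; _++_; map; concatMap; replicate; length; allFin)
open import Data.List.Relation.Unary.All using (All)
open import Data.Vec using (Vec; []; _∷_) renaming (map to vmap; lookup to vlookup)
open import Data.Maybe using (Maybe; just; nothing)
open import Data.Product using (Σ; _×_; _,_)
open import Data.Sum using (_⊎_; inj₁; inj₂)
open import Relation.Binary.PropositionalEquality using (_≡_)

-- A vocabulary consists of a designated binary symbol `succ` together
-- with s further relation symbols of arities ar i.

record Vocabulary : Set where
  field
    s  : ℕ
    ar : Fin s → ℕ

open Vocabulary public

record Structure (σ : Vocabulary) : Set where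
  field
    m     : ℕ
    succ  : Fin (suc m) → Fin (suc m) → Bool
    rel   : (i : Fin (s σ)) → Vec (Fin (suc m)) (ar σ i) → Bool

open Structure public

IsSuccessor : {σ : Vocabulary} → Structure σ → Set
IsSuccessor A = ∀ x y → (succ A x y ≡ true → suc (toℕ x) ≡ toℕ y)
                      × (suc (toℕ x) ≡ toℕ y → succ A x y ≡ true)

-- ESO universal Horn sentences  ∃R₁…∃R_r ∀x₁…x_k ψ,
-- ψ a conjunction of clauses, each with at most one positive R-atom.

module _ (σ : Vocabulary) (r : ℕ) (sar : Fin r → ℕ) (k : ℕ) where
  data Atom : Set where
    eqA   : Fin k → Fin k → Atom
    succA : Fin k → Fin k → Atom
    relA  : (i : Fin (s σ)) → Vec (Fin k) (ar σ i) → Atom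
    soA   : (j : Fin r) → Vec (Fin k) (sar j) → Atom

  data Literal : Set where
    pos : Atom → Literal
    neg : Atom → Literal

Clause : (σ : Vocabulary) (r : ℕ) (sar : Fin r → ℕ) (k : ℕ) → Set
Clause σ r sar k = List (Literal σ r sar k)

posSO : ∀ {σ r sar k} → Clause σ r sar k → ℕ
posSO [] = 0
posSO (pos (soA _ _) ∷ c) = suc (posSO c)
posSO (_ ∷ c) = posSO c

record ESOHorn (σ : Vocabulary) : Set where
  field
    r       : ℕ
    sar     : Fin r → ℕ
    k       : ℕ
    clauses : List (Clause σ r sar k)
    horn    : All (λ c → posSO c ≤ 1) clauses

open ESOHorn public

_==_ : ∀ {n} → Fin n → Fin n → Bool
Fin.zero == Fin.zero = true
Fin.zero == Fin.suc _ = false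
Fin.suc _ == Fin.zero = false
Fin.suc a == Fin.suc b = a == b

module _ {σ : Vocabulary} (A : Structure σ) {r : ℕ} {sar : Fin r → ℕ} {k : ℕ}
         (R : (j : Fin r) → Vec (Fin (suc (m A))) (sar j) → Bool)
         (ρ : Fin k → Fin (suc (m A))) where
  evalAtom : Atom σ r sar k → Bool
  evalAtom (eqA x y)   = ρ x == ρ y
  evalAtom (succA x y) = succ A (ρ x) (ρ y)
  evalAtom (relA i xs) = rel A i (vmap ρ xs)
  evalAtom (soA j xs)  = R j (vmap ρ xs)

  evalLit : Literal σ r sar k → Bool
  evalLit (pos a) = evalAtom a
  evalLit (neg a) = not (evalAtom a)

  evalClause : Clause σ r sar k → Bool
  evalClause [] = false
  evalClause (l ∷ c) = evalLit l ∨ evalClause c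

  evalMatrix : List (Clause σ r sar k) → Bool
  evalMatrix [] = true
  evalMatrix (c ∷ cs) = evalClause c ∧ evalMatrix cs

Models : {σ : Vocabulary} → Structure σ → ESOHorn σ → Set
Models A φ =
  Σ ((j : Fin (r φ)) → Vec (Fin (suc (m A))) (sar φ j) → Bool) λ R →
    (ρ : Fin (k φ) → Fin (suc (m A))) → evalMatrix A R ρ (clauses φ) ≡ true

allVecs : (n a : ℕ) → List (Vec (Fin n) a)
allVecs n zero = [] ∷ []
allVecs n (suc a) = concatMap (λ x → map (x ∷_) (allVecs n a)) (allFin n)

encode : {σ : Vocabulary} → Structure σ → List Bool
encode {σ} A =
  replicate (suc (m A)) true ++ (false ∷
  (map (λ v → succ A (vlookup v Fin.zero) (vlookup v (Fin.suc Fin.zero)))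
       (allVecs (suc (m A)) 2)
   ++ concatMap (λ i → map (rel A i) (allVecs (suc (m A)) (ar σ i))) (allFin (s σ))))

-- Deterministic single-tape Turing machines.
-- Tape alphabet Fin (3 + g): 0 = blank, 1 = bit false, 2 = bit true.

data Move : Set where
  L R S : Move

record TM : Set where
  field
    g      : ℕ
    q      : ℕ
    start  : Fin q
    -- inj₁ b : halt with answer b (true = accept)
    δ      : Fin q → Fin (3 + g) → Bool ⊎ (Fin q × Fin (3 + g) × Move)

open TM public

record Config (M : TM) : Set where
  constructor cfg
  field
    state : Fin (q M)
    left  : List (Fin (3 + g M))   -- reversed; nearest cell first
    head  : Fin (3 + g M)
    right : List (Fin (3 + g M))

blank : ∀ {g} → Fin (3 + g)
blank = Fin.zero

bitSym : ∀ {g} → Bool → Fin (3 + g)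
bitSym false = Fin.suc Fin.zero
bitSym true  = Fin.suc (Fin.suc Fin.zero)

moveHead : (M : TM) → Fin (q M) → List (Fin (3 + g M)) → Fin (3 + g M)
         → List (Fin (3 + g M)) → Move → Config M
moveHead M st l h r S = cfg st l h r
moveHead M st [] h r L = cfg st [] h r
moveHead M st (x ∷ l) h r L = cfg st l x (h ∷ r)
moveHead M st l h [] R = cfg st (h ∷ l) blank []
moveHead M st l h (x ∷ r) R = cfg st (h ∷ l) x r

initial : (M : TM) → List Bool → Config M
initial M [] = cfg (start M) [] blank []
initial M (b ∷ w) = cfg (start M) [] (bitSym b) (map bitSym w)

run : (M : TM) → ℕ → Config M → Maybe Bool
run M zero c = nothing
run M (suc t) (cfg st l h r) with δ M st h
... | inj₁ b = just b
... | inj₂ (st' , h' , mv) = run M t (moveHead M st' l h' r mv)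

InP : (σ : Vocabulary) → (Structure σ → Set) → Set
InP σ C =
  Σ TM λ M → Σ ℕ λ c → Σ ℕ λ d →
    (A : Structure σ) → Σ Bool λ b →
      (run M (c * (suc (length (encode A)) ^ d)) (initial M (encode A)) ≡ just b)
      × (b ≡ true → C A) × (C A → b ≡ true)

DefinesOnSuccessorStructures : (σ : Vocabulary) → ESOHorn σ → (Structure σ → Set) → Set
DefinesOnSuccessorStructures σ φ C =
  (A : Structure σ) → IsSuccessor A → (C A → Models A φ) × (Models A φ → C A)

module Submission where

-- ESO universal sentences (Horn or not) are preserved under
-- substructures: if A embeds into B and B ⊨ ∃R̄ ∀x̄ ψ with witnesses R̄, then
-- the pull-back of R̄ along the embedding witnesses A ⊨ ∃R̄ ∀x̄ ψ, since every
-- assignment into A is, through the embedding, an assignment into B that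
-- evaluates ψ identically.  Without constants for the endpoints, an initial
-- segment of a successor structure is again a successor structure and a
-- substructure of it; so every class defined by such a sentence on successor
-- structures is closed under initial segments.
--
-- The witness is then the polynomial-time class of
-- structures with at least two elements (over the vocabulary with only the
-- successor symbol): a two-state Turing machine decides it in two steps, yet
-- the one-element successor structure embeds into the two-element one.

open import Defs
open import Data.Bool using (Bool; true; false; _∧_; _∨_; not)
open import Data.Fin using (Fin) renaming (zero to fz; suc to fs)
open import Data.List using (List; []; _∷_; length)
open import Data.Maybe using (just)
open import Data.Nat using (ℕ; zero; suc; _*_; _^_; _≤_; z≤n; s≤s)
open import Data.Product using (Σ; _×_; _,_; proj₁; proj₂)
open import Data.Sum using (_⊎_; inj₁; inj₂)
open import Data.Vec using (Vec) renaming (map to vmap)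
open import Data.Vec.Properties using (map-∘)
open import Relation.Binary.PropositionalEquality using (_≡_; refl; cong; cong₂; sym; trans)
open import Relation.Nullary using (¬_)

record Embedding {σ : Vocabulary} (A B : Structure σ) : Set where
  field
    emb      : Fin (suc (m A)) → Fin (suc (m B))
    emb-eq   : ∀ x y → (emb x == emb y) ≡ (x == y)
    emb-succ : ∀ x y → succ B (emb x) (emb y) ≡ succ A x y
    emb-rel  : ∀ i v → rel B i (vmap emb v) ≡ rel A i v

open Embedding

module Preservation {σ : Vocabulary} {A B : Structure σ} (e : Embedding A B)
                    {r : ℕ} {sar : Fin r → ℕ} {k : ℕ}
                    (Rs : (j : Fin r) → Vec (Fin (suc (m B))) (sar j) → Bool) where

  pullback : (j : Fin r) → Vec (Fin (suc (m A))) (sar j) → Bool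
  pullback j v = Rs j (vmap (emb e) v)

  module _ (ρ : Fin k → Fin (suc (m A))) where

    ρB : Fin k → Fin (suc (m B))
    ρB x = emb e (ρ x)

    atom-invariant : (a : Atom σ r sar k) →
                     evalAtom A pullback ρ a ≡ evalAtom B Rs ρB a
    atom-invariant (eqA x y)   = sym (emb-eq e (ρ x) (ρ y))
    atom-invariant (succA x y) = sym (emb-succ e (ρ x) (ρ y))
    atom-invariant (relA i xs) =
      trans (sym (emb-rel e i (vmap ρ xs))) (cong (rel B i) (sym (map-∘ (emb e) ρ xs)))
    atom-invariant (soA j xs)  = cong (Rs j) (sym (map-∘ (emb e) ρ xs))

    literal-invariant : (l : Literal σ r sar k) →
                        evalLit A pullback ρ l ≡ evalLit B Rs ρB l
    literal-invariant (pos a) = atom-invariant a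
    literal-invariant (neg a) = cong not (atom-invariant a)

    clause-invariant : (c : Clause σ r sar k) →
                       evalClause A pullback ρ c ≡ evalClause B Rs ρB c
    clause-invariant []      = refl
    clause-invariant (l ∷ c) = cong₂ _∨_ (literal-invariant l) (clause-invariant c)

    matrix-invariant : (cs : List (Clause σ r sar k)) →
                       evalMatrix A pullback ρ cs ≡ evalMatrix B Rs ρB cs
    matrix-invariant []       = refl
    matrix-invariant (c ∷ cs) = cong₂ _∧_ (clause-invariant c) (matrix-invariant cs)

models-substructure : {σ : Vocabulary} {A B : Structure σ} (φ : ESOHorn σ) →
                      Embedding A B → Models B φ → Models A φ
models-substructure φ e (Rs , sat) =
  pullback , λ ρ → trans (matrix-invariant ρ (clauses φ)) (sat (ρB ρ))
  where open Preservation e Rs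

definable-closed : {σ : Vocabulary} {φ : ESOHorn σ} {C : Structure σ → Set} →
                   DefinesOnSuccessorStructures σ φ C →
                   {A B : Structure σ} → IsSuccessor A → IsSuccessor B →
                   Embedding A B → C B → C A
definable-closed {φ = φ} def A-succ B-succ e CB =
  proj₂ (def _ A-succ) (models-substructure φ e (proj₁ (def _ B-succ) CB))

σ₀ : Vocabulary
σ₀ = record { s = 0 ; ar = λ () }

AtLeastTwo : Structure σ₀ → Set
AtLeastTwo A = 1 ≤ m A

-- The encoding of A begins with (m A + 1) ones followed by a zero, so the
-- second tape cell holds a one exactly when A has at least two elements.
secondCellMachine : TM
secondCellMachine = record { g = 0 ; q = 2 ; start = fz ; δ = step }
  where
  step : Fin 2 → Fin 3 → Bool ⊎ (Fin 2 × Fin 3 × Move)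
  step fz             _             = inj₂ (fs fz , fz , R)
  step (fs fz)        (fs (fs fz))  = inj₁ true
  step (fs fz)        _             = inj₁ false

secondCell-decides : (A : Structure σ₀) → Σ Bool λ b →
  (run secondCellMachine (2 * (suc (length (encode A)) ^ 0))
       (initial secondCellMachine (encode A)) ≡ just b)
  × (b ≡ true → AtLeastTwo A) × (AtLeastTwo A → b ≡ true)
secondCell-decides record { m = zero }  = false , refl , (λ ()) , (λ ())
secondCell-decides record { m = suc _ } = true , refl , (λ _ → s≤s z≤n) , (λ _ → refl)

atLeastTwo-inP : InP σ₀ AtLeastTwo
atLeastTwo-inP = secondCellMachine , 2 , 0 , secondCell-decides

point : Structure σ₀
point = record { m = 0 ; succ = λ _ _ → false ; rel = λ () }

edge : Structure σ₀
edge = record { m = 1 ; succ = succ01 ; rel = λ () }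
  where
  succ01 : Fin 2 → Fin 2 → Bool
  succ01 fz (fs fz) = true
  succ01 _  _       = false

point-successor : IsSuccessor point
point-successor fz fz = (λ ()) , (λ ())

edge-successor : IsSuccessor edge
edge-successor fz      fz      = (λ ()) , (λ ())
edge-successor fz      (fs fz) = (λ _ → refl) , (λ _ → refl)
edge-successor (fs fz) fz      = (λ ()) , (λ ())
edge-successor (fs fz) (fs fz) = (λ ()) , (λ ())

point↪edge : Embedding point edge
point↪edge = record
  { emb      = λ _ → fz
  ; emb-eq   = λ { fz fz → refl }
  ; emb-succ = λ { fz fz → refl }
  ; emb-rel  = λ ()
  }

theorem1 : Σ Vocabulary λ σ → Σ (Structure σ → Set) λ C →
             InP σ C × ¬ (Σ (ESOHorn σ) λ φ → DefinesOnSuccessorStructures σ φ C)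
theorem1 = σ₀ , AtLeastTwo , atLeastTwo-inP , not-definable
  where
  -- A defining sentence would transfer "at least two elements" from the
  -- edge down to the point.
  not-definable : ¬ (Σ (ESOHorn σ₀) λ φ → DefinesOnSuccessorStructures σ₀ φ AtLeastTwo)
  not-definable (φ , def)
    with definable-closed {φ = φ} def point-successor edge-successor point↪edge (s≤s z≤n)
  ... | ()
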